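{- Let $u$ be a vertex of a graph $G$ and let $P$ be a $u$-path of length $p$. Let $S$ be the set of vertices $v\in V(P)$ such that there is a reroute of $P$ whose end is $v$. Then for every $v\in S$, $e(v,V(P))-e(v,S)/2\le (p+1)/2$.
   Context: Graphs are finite and simple. A $u$-path is a path one of whose ends is $u$; its end means its other end. The length of a path is its number of edges. A reroute of a $u$-path $P$ is a $u$-path $P'$ with $V(P')=V(P)$. For a vertex $v$ and a vertex set $A$, $e(v,A)$ is the number of edges joining $v$ to a vertex of $A$. -}

module Defs where

open import Data.Nat using (ℕ; suc)
open import Data.Bool using (Bool; T; _∧_)
open import Data.Fin using (Fin; _≟_)
open import Data.List using (List; []; _∷_; length; filter; allFin)
open import Data.List.Relation.Unary.Unique.Propositional using (Unique)
open import Data.List.Relation.Unary.Linked using (Linked)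
open import Data.List.Membership.Propositional using (_∈_)
import Data.List.Membership.DecPropositional as DecMem
open import Data.Product using (_×_; Σ-syntax)
open import Relation.Nullary using (¬_; does)
open import Relation.Nullary.Decidable using (T?)
open import Relation.Binary.PropositionalEquality using (_≡_)
open import Function.Bundles using (_⇔_)

record Graph (n : ℕ) : Set where
  field
    adj    : Fin n → Fin n → Bool
    sym    : ∀ x y → adj x y ≡ adj y x
    irrefl : ∀ x → adj x x ≡ Data.Bool.false

open Graph public

Adj : ∀ {n} → Graph n → Fin n → Fin n → Set
Adj G x y = T (adj G x y)

-- A u-path is represented by the list of its vertices u ∷ xs (in order from u):
-- distinct vertices, consecutive ones adjacent.
IsUPath : ∀ {n} → Graph n → Fin n → List (Fin n) → Set
IsUPath G u xs = Unique (u ∷ xs) × Linked (Adj G) (u ∷ xs)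

-- length of the u-path u ∷ xs (number of edges)
pathLength : ∀ {n} → List (Fin n) → ℕ
pathLength xs = length xs

endOf : ∀ {n} → Fin n → List (Fin n) → Fin n
endOf u []       = u
endOf u (x ∷ xs) = endOf x xs

IsReroute : ∀ {n} → Graph n → Fin n → List (Fin n) → List (Fin n) → Set
IsReroute G u xs ys = IsUPath G u ys × (∀ w → (w ∈ u ∷ ys) ⇔ (w ∈ u ∷ xs))

VP : ∀ {n} → Fin n → List (Fin n) → Fin n → Bool
VP {n} u xs w = does (DecMem._∈?_ (_≟_ {n}) w (u ∷ xs))

e : ∀ {n} → Graph n → Fin n → (Fin n → Bool) → ℕ
e {n} G v A = length (filter (λ w → T? (adj G v w ∧ A w)) (allFin n))

IsRerouteEndSet : ∀ {n} → Graph n → Fin n → List (Fin n) → (Fin n → Bool) → Set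
IsRerouteEndSet G u xs S =
  ∀ w → T (S w) ⇔ ((w ∈ u ∷ xs) × (Σ[ ys ∈ List (Fin _) ] (IsReroute G u xs ys × endOf u ys ≡ w)))

module Submission where

-- Idea of the proof (the classical Pósa rotation argument).
-- Since v ∈ S, some reroute P' = x₀ x₁ … x_p of P (x₀ = u) ends at v, and P'
-- has the same vertex set as P.  Every reroute of P' is a reroute of P, so its
-- end lies in S.  Rotation: if v is adjacent to x_i (i < p), then
-- x₀ … x_i x_p x_{p-1} … x_{i+1} is a reroute of P' ending at x_{i+1}; hence
--     v ~ x_i  implies  x_{i+1} ∈ S                                        (★)
-- Summing the local inequality [v~x_i] + [v~x_{i+1}] ≤ [v~x_{i+1} and x_{i+1} ∈ S] + 1,
-- which holds by (★), over all consecutive pairs, and using that v = x_p is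
-- not adjacent to itself, gives  2·e(v,V(P)) ≤ e(v,S) + (p + 1).

open import Defs
open import Data.Nat using (ℕ; suc; _+_; _*_; _≤_; z≤n)
open import Data.Nat.Properties using (≤-refl; ≤-reflexive; +-mono-≤; +-identityʳ; m≤n+m; module ≤-Reasoning)
open import Data.Nat.Tactic.RingSolver using (solve-∀)
open import Data.Bool using (Bool; T; true; false; _∧_)
open import Data.Bool.Properties using (T-∧)
open import Data.Fin using (Fin; _≟_)
open import Data.List using (List; []; _∷_; length; filter; allFin; reverse; _ʳ++_)
open import Data.List.Membership.Propositional using (_∈_)
open import Data.List.Membership.Propositional.Properties using (∈-filter⁺; ∈-filter⁻; ∈-allFin)
open import Data.List.Membership.Propositional.Properties.WithK using (unique∧set⇒bag)
import Data.List.Membership.DecPropositional as DecMem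
open import Data.List.Relation.Unary.Any using (here; there)
open import Data.List.Relation.Unary.All.Properties using (¬Any⇒All¬; All¬⇒¬Any)
open import Data.List.Relation.Unary.AllPairs as AllPairs using (_∷_)
open import Data.List.Relation.Unary.Linked as Linked using (Linked; [-]; _∷_)
open import Data.List.Relation.Unary.Unique.Propositional using (Unique)
import Data.List.Relation.Unary.Unique.Propositional.Properties as Unique
open import Data.List.Relation.Binary.BagAndSetEquality using (∼bag⇒↭; ∷-cong)
open import Data.List.Relation.Binary.Permutation.Propositional using (_↭_; ↭-sym; prep; ↭⇒↭ₛ)
open import Data.List.Relation.Binary.Permutation.Propositional.Properties
  using (↭-length; filter-↭; ↭-reverse; ∈-resp-↭)
import Data.List.Relation.Binary.Permutation.Setoid.Properties as PermSetoid
open import Data.List.Relation.Binary.Sublist.Propositional using (⊆-refl)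
import Data.List.Relation.Binary.Sublist.Propositional.Properties as Sublist
open import Data.Empty using (⊥-elim)
open import Data.Product using (_,_; proj₁; proj₂)
open import Relation.Nullary using (does; yes; no)
open import Relation.Nullary.Decidable using (T?)
open import Relation.Unary using (Decidable)
open import Relation.Binary.PropositionalEquality using (_≡_; refl; cong; subst; setoid)
open import Function using (_∘_)
open import Function.Bundles using (_⇔_; mk⇔; Equivalence)
import Function.Properties.Equivalence as ⇔

bit : Bool → ℕ
bit true  = 1
bit false = 0

bit≤1 : ∀ b → bit b ≤ 1
bit≤1 true  = ≤-refl
bit≤1 false = z≤n

count : ∀ {A : Set} → (A → Bool) → List A → ℕ
count f xs = length (filter (λ x → T? (f x)) xs)

count-∷ : ∀ {A : Set} (f : A → Bool) x xs → count f (x ∷ xs) ≡ bit (f x) + count f xs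
count-∷ f x xs with f x
... | true  = refl
... | false = refl

count-↭ : ∀ {A : Set} (f : A → Bool) {xs ys} → xs ↭ ys → count f xs ≡ count f ys
count-↭ f xs↭ys = ↭-length (filter-↭ (λ x → T? (f x)) xs↭ys)

count-mono : ∀ {A : Set} {f g : A → Bool} → (∀ x → T (f x) → T (g x)) →
             ∀ xs → count f xs ≤ count g xs
count-mono {f = f} {g} f⇒g xs =
  Sublist.length-mono-≤
    (Sublist.filter⁺ (λ x → T? (f x)) (λ x → T? (g x)) (λ { refl → f⇒g _ }) (⊆-refl {x = xs}))

mem : ∀ {n} → List (Fin n) → Fin n → Bool
mem {n} L w = does (DecMem._∈?_ (_≟_ {n}) w L)

mem⇔∈ : ∀ {n} {L : List (Fin n)} {w} → T (mem L w) ⇔ w ∈ L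
mem⇔∈ {n} {L} {w} with DecMem._∈?_ (_≟_ {n}) w L
... | yes w∈L = mk⇔ (λ _ → w∈L) _
... | no  w∉L = mk⇔ (λ ()) w∉L

-- Counting the vertices in a duplicate-free list L that satisfy f, over the whole
-- vertex set, is counting along L: both filtered lists are duplicate-free with the
-- same elements, hence permutations of each other.
count-restrict : ∀ {n} (f : Fin n → Bool) {L} → Unique L →
                 count (λ w → f w ∧ mem L w) (allFin n) ≡ count f L
count-restrict {n} f {L} uniq =
  ↭-length (∼bag⇒↭ (unique∧set⇒bag (Unique.filter⁺ inL? (Unique.allFin⁺ n))
                                   (Unique.filter⁺ f? uniq) same))
  where
  inL? : Decidable (λ w → T (f w ∧ mem L w))
  inL? w = T? (f w ∧ mem L w)
  f? : Decidable (λ w → T (f w))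
  f? w = T? (f w)
  same : ∀ {w} → w ∈ filter inL? (allFin n) ⇔ w ∈ filter f? L
  same {w} = mk⇔
    (λ w∈ → let fw , w∈L = Equivalence.to (T-∧ {f w}) (proj₂ (∈-filter⁻ inL? {xs = allFin n} w∈))
            in ∈-filter⁺ f? (Equivalence.to (mem⇔∈ {L = L}) w∈L) fw)
    (λ w∈ → let w∈L , fw = ∈-filter⁻ f? {xs = L} w∈
            in ∈-filter⁺ inL? (∈-allFin w) (Equivalence.from T-∧ (fw , Equivalence.from (mem⇔∈ {L = L}) w∈L)))

count-within : ∀ {n} (f : Fin n → Bool) {L} → Unique L → count f L ≤ count f (allFin n)
count-within {n} f {L} uniq = begin
  count f L                                   ≡⟨ count-restrict f uniq ⟨
  count (λ w → f w ∧ mem L w) (allFin n)      ≤⟨ count-mono (λ w → proj₁ ∘ Equivalence.to (T-∧ {f w})) (allFin n) ⟩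
  count f (allFin n)                          ∎
  where open ≤-Reasoning

endOf-∈ : ∀ {n} (u : Fin n) xs → endOf u xs ∈ u ∷ xs
endOf-∈ u []       = here refl
endOf-∈ u (x ∷ xs) = there (endOf-∈ x xs)

endOf-ʳ++ : ∀ {n} (x y : Fin n) β acc → endOf x (β ʳ++ (y ∷ acc)) ≡ endOf y acc
endOf-ʳ++ x y []      acc = refl
endOf-ʳ++ x y (z ∷ β) acc = endOf-ʳ++ x z β (y ∷ acc)

rotate-linked : ∀ {n} {R : Fin n → Fin n → Set} → (∀ {a b} → R a b → R b a) →
                ∀ {x} y β acc → R x (endOf y β) → Linked R (y ∷ β) → Linked R (y ∷ acc) →
                Linked R (x ∷ (β ʳ++ (y ∷ acc)))
rotate-linked sym y []      acc xRend _          y-acc = xRend ∷ y-acc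
rotate-linked sym y (z ∷ β) acc xRend (yRz ∷ zβ) y-acc = rotate-linked sym z β (y ∷ acc) xRend zβ (sym yRz ∷ y-acc)

symAdj : ∀ {n} (G : Graph n) {a b} → Adj G a b → Adj G b a
symAdj G {a} {b} = subst T (Defs.sym G a b)

-- Pósa rotation: if the end of the x-path x y … is adjacent to x, reversing
-- everything after x gives a reroute (which ends at y, by endOf-ʳ++).
posa-rotation : ∀ {n} (G : Graph n) {x y β} → IsUPath G x (y ∷ β) → Adj G x (endOf y β) →
                IsReroute G x (y ∷ β) (reverse (y ∷ β))
posa-rotation {n} G {x} {y} {β} (uniq , xyβ) x~end =
  (PermSetoid.Unique-resp-↭ (setoid (Fin n)) (↭⇒↭ₛ (↭-sym reversal)) uniq ,
   rotate-linked (symAdj G) y β [] x~end (Linked.tail xyβ) [-]) ,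
  λ w → mk⇔ (∈-resp-↭ reversal) (∈-resp-↭ (↭-sym reversal))
  where
  reversal : (x ∷ reverse (y ∷ β)) ↭ (x ∷ y ∷ β)
  reversal = prep x (↭-reverse (y ∷ β))

prepend-reroute : ∀ {n} (G : Graph n) {x y β β'} → IsUPath G x (y ∷ β) →
                  IsReroute G y β β' → IsReroute G x (y ∷ β) (y ∷ β')
prepend-reroute G {x} (x∉ ∷ _ , x~y ∷ _) ((uniq' , linked') , same) =
  (¬Any⇒All¬ _ (All¬⇒¬Any x∉ ∘ Equivalence.to (same x)) ∷ uniq' , x~y ∷ linked') ,
  λ w → ∷-cong refl (λ {z} → same z)

reroute-trans : ∀ {n} (G : Graph n) {u xs ys zs} →
                IsReroute G u xs ys → IsReroute G u ys zs → IsReroute G u xs zs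
reroute-trans G (_ , xs≈ys) (pathZ , ys≈zs) = pathZ , λ w → ⇔.trans (ys≈zs w) (xs≈ys w)

-- A path and its reroute list the same vertices, each once: they are permutations.
reroute-↭ : ∀ {n} (G : Graph n) {u xs ys} → IsUPath G u xs → IsReroute G u xs ys →
            (u ∷ ys) ↭ (u ∷ xs)
reroute-↭ G (uniq , _) ((uniq' , _) , same) = ∼bag⇒↭ (unique∧set⇒bag uniq' uniq (λ {w} → same w))

reroute-end-∈S : ∀ {n} (G : Graph n) {u xs S} → IsRerouteEndSet G u xs S →
                 ∀ {ys} → IsReroute G u xs ys → T (S (endOf u ys))
reroute-end-∈S G {u} spec {ys} r@(_ , same) =
  Equivalence.from (spec _) (Equivalence.to (same _) (endOf-∈ u ys) , ys , r , refl)

Propagates : ∀ {A : Set} → (A → Bool) → (A → Bool) → A → A → Set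
Propagates a s x y = T (a x) → T (s y)

-- (★): if all reroutes of the x-path x ∷ zs end in S, then along the path,
-- adjacency of a vertex to the end forces its successor into S.  The hypothesis
-- passes to the tail by prepend-reroute.
reroute-ends-propagate : ∀ {n} (G : Graph n) (S : Fin n → Bool) {x} zs → IsUPath G x zs →
                         (∀ {zs'} → IsReroute G x zs zs' → T (S (endOf x zs'))) →
                         Linked (Propagates (adj G (endOf x zs)) S) (x ∷ zs)
reroute-ends-propagate G S []      _    _    = [-]
reroute-ends-propagate G S {x} (y ∷ β) path ends =
  rotated ∷ reroute-ends-propagate G S β tailPath (ends ∘ prepend-reroute G path)
  where
  tailPath : IsUPath G y β
  tailPath = AllPairs.tail (proj₁ path) , Linked.tail (proj₂ path)
  rotated : Propagates (adj G (endOf y β)) S x y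
  rotated end~x = subst (T ∘ S) (endOf-ʳ++ x y β []) (ends (posa-rotation G path (symAdj G end~x)))

pair-bound : ∀ a b s → (T b → T s) → bit a + bit b ≤ bit (a ∧ s) + 1
pair-bound false false s  _   = z≤n
pair-bound false true  s  _   = ≤-refl
pair-bound true  false s  _   = m≤n+m 1 (bit s)
pair-bound true  true  false b⇒s = ⊥-elim (b⇒s _)
pair-bound true  true  true  _   = ≤-refl

-- Summing pair-bound along a Propagates-chain whose last vertex fails a.  The
-- flag b records that the head is forced into s by its predecessor.
propagation-count : ∀ {n} (a s : Fin n → Bool) b x L → (T b → T (s x)) →
                    Linked (Propagates a s) (x ∷ L) → a (endOf x L) ≡ false →
                    2 * count a (x ∷ L) + bit b ≤ count (λ w → a w ∧ s w) (x ∷ L) + length (x ∷ L)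
propagation-count a s b x [] _ _ ax≡false = begin
  2 * count a (x ∷ []) + bit b          ≡⟨ cong (λ k → 2 * k + bit b) (count-∷ a x []) ⟩
  2 * (bit (a x) + 0) + bit b           ≡⟨ cong (λ c → 2 * (bit c + 0) + bit b) ax≡false ⟩
  bit b                                 ≤⟨ bit≤1 b ⟩
  1                                     ≤⟨ m≤n+m 1 _ ⟩
  count (λ w → a w ∧ s w) (x ∷ []) + 1  ∎
  where open ≤-Reasoning
propagation-count a s b x (y ∷ L) b⇒sx (ax⇒sy ∷ chain) last = begin
  2 * count a (x ∷ y ∷ L) + bit b                 ≡⟨ cong (λ k → 2 * k + bit b) (count-∷ a x (y ∷ L)) ⟩
  2 * (bit (a x) + C) + bit b                     ≡⟨ regroupˡ (bit (a x)) C (bit b) ⟩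
  (2 * C + bit (a x)) + (bit (a x) + bit b)       ≤⟨ +-mono-≤ (propagation-count a s (a x) y L ax⇒sy chain last)
                                                              (pair-bound (a x) b (s x) b⇒sx) ⟩
  (CS + length (y ∷ L)) + (bit (a x ∧ s x) + 1)   ≡⟨ regroupʳ (bit (a x ∧ s x)) CS (length L) ⟩
  (bit (a x ∧ s x) + CS) + length (x ∷ y ∷ L)     ≡⟨ cong (_+ length (x ∷ y ∷ L)) (count-∷ (λ w → a w ∧ s w) x (y ∷ L)) ⟨
  count (λ w → a w ∧ s w) (x ∷ y ∷ L) + length (x ∷ y ∷ L) ∎
  where
  open ≤-Reasoning
  C CS : ℕ
  C  = count a (y ∷ L)
  CS = count (λ w → a w ∧ s w) (y ∷ L)
  regroupˡ : ∀ p c q → 2 * (p + c) + q ≡ (2 * c + p) + (p + q)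
  regroupˡ = solve-∀
  regroupʳ : ∀ p c l → (c + suc l) + (p + 1) ≡ (p + c) + suc (suc l)
  regroupʳ = solve-∀

lemma1 : ∀ {n} (G : Graph n) (u : Fin n) (xs : List (Fin n)) →
         IsUPath G u xs →
         (S : Fin n → Bool) → IsRerouteEndSet G u xs S →
         ∀ v → T (S v) →
         2 * e G v (VP u xs) ≤ e G v S + suc (pathLength xs)
lemma1 G u xs path S spec v sv with Equivalence.to (spec v) sv
... | _ , ys , r@(path' , _) , refl = begin
  2 * e G v (VP u xs)                       ≡⟨ cong (2 *_) (count-restrict a (proj₁ path)) ⟩
  2 * count a (u ∷ xs)                      ≡⟨ cong (2 *_) (count-↭ a (↭-sym P'↭P)) ⟩
  2 * count a (u ∷ ys)                      ≡⟨ +-identityʳ _ ⟨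
  2 * count a (u ∷ ys) + bit false          ≤⟨ propagation-count a S false u ys (λ ()) rotation-★ (irrefl G v) ⟩
  count (λ w → a w ∧ S w) (u ∷ ys) + length (u ∷ ys)
                                            ≤⟨ +-mono-≤ (count-within _ (proj₁ path')) (≤-reflexive (↭-length P'↭P)) ⟩
  e G v S + suc (pathLength xs)             ∎
  where
  open ≤-Reasoning
  a : Fin _ → Bool
  a = adj G v
  P'↭P : (u ∷ ys) ↭ (u ∷ xs)
  P'↭P = reroute-↭ G path r
  rotation-★ : Linked (Propagates a S) (u ∷ ys)
  rotation-★ = reroute-ends-propagate G S ys path' (reroute-end-∈S G spec ∘ reroute-trans G r)
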